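{- (i) There is no $5$-$\gamma_{tR}$-edge-supercritical graph. (ii) If $G$ is the disjoint union of $k\geq 2$ complete graphs, each of order at least $3$, then $G$ is $3k$-$\gamma_{tR}$-edge-supercritical.
   Context: All graphs are finite and simple. For a graph $G$ with no isolated vertices, a total Roman dominating function is a map $f:V(G)\to\{0,1,2\}$ such that every vertex with $f(v)=0$ is adjacent to a vertex $u$ with $f(u)=2$, and the subgraph induced by $\{v:f(v)>0\}$ has no isolated vertices; $\gamma_{tR}(G)$ is the minimum of $\sum_v f(v)$ over such $f$. A graph $G$ (with no isolated vertices) is $\gamma_{tR}$-edge-supercritical if $E(\overline{G})\neq\emptyset$ and $\gamma_{tR}(G+e)\leq\gamma_{tR}(G)-2$ for every $e\in E(\overline{G})$; it is $k$-$\gamma_{tR}$-edge-supercritical if in addition $\gamma_{tR}(G)=k$. -}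

module Defs where

open import Data.Nat using (ℕ; zero; suc; _+_; _≤_; _<_)
open import Data.Bool using (not; Bool; true; false; _∧_; _∨_)
open import Data.Fin using (Fin)
open import Data.Fin.Properties using (_≟_)
open import Data.List using (map; allFin)
open import Data.Nat.ListAction using (sum)
open import Data.Product using (Σ; ∃; _×_; _,_)
open import Relation.Nullary using (¬_)
open import Relation.Nullary.Decidable using (⌊_⌋)
open import Relation.Binary.PropositionalEquality using (_≡_; refl; trans; sym)
open import Data.Empty using (⊥-elim)
open import Relation.Nullary using (yes; no)

record Graph (n : ℕ) : Set where
  field
    adj   : Fin n → Fin n → Bool
    adjSym : ∀ u v → adj u v ≡ adj v u
    irref : ∀ v → adj v v ≡ false
open Graph public

Adj : ∀ {n} → Graph n → Fin n → Fin n → Set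
Adj G u v = adj G u v ≡ true

NoIsolated : ∀ {n} → Graph n → Set
NoIsolated {n} G = ∀ (v : Fin n) → ∃ λ u → Adj G v u

NonEdge : ∀ {n} → Graph n → Fin n → Fin n → Set
NonEdge G u v = ¬ (u ≡ v) × ¬ Adj G u v

addAdj : ∀ {n} → Graph n → Fin n → Fin n → Fin n → Fin n → Bool
addAdj G u v x y =
  adj G x y ∨ ((⌊ x ≟ u ⌋ ∧ ⌊ y ≟ v ⌋) ∨ (⌊ x ≟ v ⌋ ∧ ⌊ y ≟ u ⌋))

module _ {n : ℕ} (G : Graph n) (u v : Fin n) where
  private
    ∨-comm : ∀ a b → (a ∨ b) ≡ (b ∨ a)
    ∨-comm false false = refl
    ∨-comm false true = refl
    ∨-comm true false = refl
    ∨-comm true true = refl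
    ∧-comm : ∀ a b → (a ∧ b) ≡ (b ∧ a)
    ∧-comm false false = refl
    ∧-comm false true = refl
    ∧-comm true false = refl
    ∧-comm true true = refl

  addSym : ∀ x y → addAdj G u v x y ≡ addAdj G u v y x
  addSym x y rewrite adjSym G x y
                   | ∧-comm ⌊ x ≟ u ⌋ ⌊ y ≟ v ⌋
                   | ∧-comm ⌊ x ≟ v ⌋ ⌊ y ≟ u ⌋
                   | ∨-comm (⌊ y ≟ v ⌋ ∧ ⌊ x ≟ u ⌋) (⌊ y ≟ u ⌋ ∧ ⌊ x ≟ v ⌋)
                   = refl

  addIrr : ¬ (u ≡ v) → ∀ x → addAdj G u v x x ≡ false
  addIrr u≢v x rewrite irref G x with x ≟ u | x ≟ v
  ... | yes p | yes q = ⊥-elim (u≢v (trans (sym p) q))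
  ... | yes p | no q = refl
  ... | no p | yes q = refl
  ... | no p | no q = refl

addEdge : ∀ {n} (G : Graph n) (u v : Fin n) → NonEdge G u v → Graph n
addEdge G u v (u≢v , _) = record
  { adj = addAdj G u v ; adjSym = addSym G u v ; irref = addIrr G u v u≢v }

weight : ∀ {n} → (Fin n → ℕ) → ℕ
weight {n} f = sum (map f (allFin n))

record IsTRDF {n : ℕ} (G : Graph n) (f : Fin n → ℕ) : Set where
  field
    range : ∀ v → f v ≤ 2
    dom   : ∀ v → f v ≡ 0 → ∃ λ u → Adj G v u × f u ≡ 2
    total : ∀ v → 0 < f v → ∃ λ u → Adj G v u × 0 < f u

GammaTR : ∀ {n} → Graph n → ℕ → Set
GammaTR {n} G k =
  (Σ (Fin n → ℕ) λ f → IsTRDF G f × weight f ≡ k)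
  × (∀ (f : Fin n → ℕ) → IsTRDF G f → k ≤ weight f)

EdgeSupercritical : ∀ {n} → Graph n → ℕ → Set
EdgeSupercritical {n} G k =
  NoIsolated G × GammaTR G k
  × (Σ (Fin n) λ u → Σ (Fin n) λ v → NonEdge G u v)
  × (∀ u v (e : NonEdge G u v) → ∀ m → GammaTR (addEdge G u v e) m → m + 2 ≤ k)

-- Disjoint union of complete graphs, given by a component labelling c
-- (u ~ v iff u ≠ v and c u = c v).
cliquesAdj : ∀ {n k} → (Fin n → Fin k) → Fin n → Fin n → Bool
cliquesAdj c x y = ⌊ c x ≟ c y ⌋ ∧ not ⌊ x ≟ y ⌋

cliquesSym : ∀ {n k} (c : Fin n → Fin k) x y → cliquesAdj c x y ≡ cliquesAdj c y x
cliquesSym c x y with c x ≟ c y | c y ≟ c x | x ≟ y | y ≟ x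
... | yes _ | yes _ | yes _ | yes _ = refl
... | yes _ | yes _ | yes p | no q = ⊥-elim (q (sym p))
... | yes _ | yes _ | no p | yes q = ⊥-elim (p (sym q))
... | yes _ | yes _ | no _ | no _ = refl
... | yes p | no q | _ | _ = ⊥-elim (q (sym p))
... | no p | yes q | _ | _ = ⊥-elim (p (sym q))
... | no _ | no _ | _ | _ = refl

cliquesIrr : ∀ {n k} (c : Fin n → Fin k) x → cliquesAdj c x x ≡ false
cliquesIrr c x with c x ≟ c x | x ≟ x
... | yes _ | yes _ = refl
... | yes _ | no p = ⊥-elim (p refl)
... | no _ | _ = refl

Cliques : ∀ {n k} → (Fin n → Fin k) → Graph n
Cliques c = record { adj = cliquesAdj c ; adjSym = cliquesSym c ; irref = cliquesIrr c }

AtLeast3 : ∀ {n k} → (Fin n → Fin k) → Fin k → Set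
AtLeast3 {n} c i = Σ (Fin n) λ a → Σ (Fin n) λ b → Σ (Fin n) λ d →
  c a ≡ i × c b ≡ i × c d ≡ i × ¬ (a ≡ b) × ¬ (a ≡ d) × ¬ (b ≡ d)

module Submission where

-- (i) If G is 5-supercritical and uv is a nonedge, then γ_tR(G + uv) ≤ 3. On at least five
-- vertices a total Roman dominating function of weight at most 3 has a vertex of value 0, so it
-- is a vertex w of value 2 with one neighbour of value 1, and w dominates everything else.
-- Removing uv again, w is adjacent in G to all vertices except at most one vertex q, and the edge
-- from w to a neighbour of q dominates G: the value 2 on its ends gives γ_tR(G) ≤ 4.
-- (ii) Every clique carries weight at least 3 (a vertex of value 0 forces a 2 and a positive
-- neighbour of it inside the clique, otherwise three vertices are positive), and 2 + 1 per clique
-- attains this. After joining u and v from different cliques, the value 2 on u and on v alone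
-- takes care of both cliques, saving 2.

open import Defs
open import Data.Bool using (T; _∧_; if_then_else_)
open import Data.Bool.Properties using (T-≡; T-∨; T-∧; ∨-zeroʳ)
open import Data.Empty using (⊥)
open import Data.Fin using (Fin; zero; suc; punchIn; punchOut)
open import Data.Fin.Properties
  using (_≟_; any?; punchInᵢ≢i; punchIn-punchOut; punchIn-injective; punchOut-injective)
open import Data.List using (tabulate)
open import Data.List.Properties using (map-tabulate)
import Data.Nat.ListAction as List
open import Data.Nat using (ℕ; zero; suc; _+_; _*_; _≤_; _<_; _≤?_; z≤n; s≤s) renaming (_≟_ to _≟ℕ_)
open import Data.Nat.Properties
  using ( +-0-commutativeMonoid; module ≤-Reasoning; ≤-refl; ≤-trans; ≤⇒≯; ≰⇒>; n≤1+n; m≤m+n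
        ; +-mono-≤; +-monoʳ-≤; +-monoˡ-≤; +-cancelˡ-≤; +-cancelʳ-≤; +-identityʳ; +-assoc
        ; *-comm; *-identityʳ; n≢0⇒n>0; n≤0⇒n≡0 )
open import Data.Nat.Induction using (<-rec)
open import Algebra.Properties.CommutativeMonoid.Sum +-0-commutativeMonoid
  using (sum; sum-remove; sum-replicate-zero; ∑-distrib-+; ∑-comm; sum-cong-≗)
open import Data.Product using (Σ; ∃; _×_; _,_; proj₁; proj₂)
import Data.Product as Product
open import Data.Sum using (_⊎_; inj₁; inj₂)
import Data.Sum as Sum
open import Function using (_∘_; id; Equivalence)
open import Relation.Nullary using (¬_; Dec; yes; no; contradiction)
open import Relation.Nullary.Decidable using (⌊_⌋; toWitness)
open import Relation.Binary.PropositionalEquality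

open Equivalence using (to; from)

private variable
  n k : ℕ

weight≡sum : (f : Fin n → ℕ) → weight f ≡ sum f
weight≡sum f = trans (cong List.sum (map-tabulate id f)) (sum-tabulate f)
  where
  sum-tabulate : ∀ {m} (g : Fin m → ℕ) → List.sum (tabulate g) ≡ sum g
  sum-tabulate {zero} g = refl
  sum-tabulate {suc m} g = cong (g zero +_) (sum-tabulate (g ∘ suc))

sum-mono-≤ : {f g : Fin n → ℕ} → (∀ i → f i ≤ g i) → sum f ≤ sum g
sum-mono-≤ {zero} f≤g = z≤n
sum-mono-≤ {suc n} f≤g = +-mono-≤ (f≤g zero) (sum-mono-≤ (f≤g ∘ suc))

sum-const : ∀ n a → sum {n} (λ _ → a) ≡ n * a
sum-const zero a = refl
sum-const (suc n) a = cong (a +_) (sum-const n a)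

sum-ones : ∀ n → sum {n} (λ _ → 1) ≡ n
sum-ones n = trans (sum-const n 1) (*-identityʳ n)

sum<n⇒zero : (f : Fin n → ℕ) → sum f < n → ∃ λ i → f i ≡ 0
sum<n⇒zero {n} f sum<n with any? (λ i → f i ≟ℕ 0)
... | yes zero-at = zero-at
... | no no-zero = contradiction sum<n (≤⇒≯ n≤sum)
  where
  open ≤-Reasoning
  n≤sum : n ≤ sum f
  n≤sum = begin
    n                  ≡⟨ sum-ones n ⟨
    sum {n} (λ _ → 1)  ≤⟨ sum-mono-≤ (λ i → n≢0⇒n>0 (λ fi≡0 → no-zero (i , fi≡0))) ⟩
    sum f              ∎

lookup≤sum : (f : Fin n → ℕ) (i : Fin n) → f i ≤ sum f
lookup≤sum {suc n} f i = subst (f i ≤_) (sym (sum-remove {i = i} f)) (m≤m+n _ _)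

pair≤sum : (f : Fin n → ℕ) {i j : Fin n} → i ≢ j → f i + f j ≤ sum f
pair≤sum {suc n} f {i} {j} i≢j = begin
  f i + f j                                   ≡⟨ cong (λ l → f i + f l) (punchIn-punchOut i≢j) ⟨
  f i + (f ∘ punchIn i) (punchOut i≢j)        ≤⟨ +-monoʳ-≤ (f i) (lookup≤sum (f ∘ punchIn i) (punchOut i≢j)) ⟩
  f i + sum (f ∘ punchIn i)                   ≡⟨ sum-remove {i = i} f ⟨
  sum f                                       ∎
  where open ≤-Reasoning

triple≤sum : (f : Fin n → ℕ) {i j k : Fin n} → i ≢ j → i ≢ k → j ≢ k → f i + f j + f k ≤ sum f
triple≤sum {suc n} f {i} {j} {k} i≢j i≢k j≢k = begin
  f i + f j + f k                             ≡⟨ +-assoc (f i) (f j) (f k) ⟩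
  f i + (f j + f k)                           ≡⟨ cong₂ (λ l m → f i + (f l + f m))
                                                       (punchIn-punchOut i≢j) (punchIn-punchOut i≢k) ⟨
  f i + (f′ (punchOut i≢j) + f′ (punchOut i≢k)) ≤⟨ +-monoʳ-≤ (f i)
                                                    (pair≤sum f′ (j≢k ∘ punchOut-injective i≢j i≢k)) ⟩
  f i + sum f′                                ≡⟨ sum-remove {i = i} f ⟨
  sum f                                       ∎
  where
  open ≤-Reasoning
  f′ = f ∘ punchIn i

sum-single : (f : Fin n → ℕ) {i : Fin n} → (∀ j → j ≢ i → f j ≡ 0) → sum f ≡ f i
sum-single {suc n} f {i} f≡0 = begin
  sum f                       ≡⟨ sum-remove {i = i} f ⟩
  f i + sum (f ∘ punchIn i)   ≡⟨ cong (f i +_) (sum-cong-≗ (λ j → f≡0 _ (punchInᵢ≢i i j))) ⟩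
  f i + sum {n} (λ _ → 0)     ≡⟨ cong (f i +_) (sum-replicate-zero n) ⟩
  f i + 0                     ≡⟨ +-identityʳ (f i) ⟩
  f i                         ∎
  where open ≡-Reasoning

sum-pair : (f : Fin n → ℕ) {i j : Fin n} → i ≢ j → (∀ l → l ≢ i → l ≢ j → f l ≡ 0) →
           sum f ≡ f i + f j
sum-pair {suc n} f {i} {j} i≢j f≡0 = begin
  sum f                                  ≡⟨ sum-remove {i = i} f ⟩
  f i + sum (f ∘ punchIn i)              ≡⟨ cong (f i +_) (sum-single (f ∘ punchIn i) outside) ⟩
  f i + f (punchIn i (punchOut i≢j))     ≡⟨ cong (λ l → f i + f l) (punchIn-punchOut i≢j) ⟩
  f i + f j                              ∎
  where
  open ≡-Reasoning
  outside : ∀ l → l ≢ punchOut i≢j → f (punchIn i l) ≡ 0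
  outside l l≢j′ = f≡0 _ (punchInᵢ≢i i l)
    (λ eq → l≢j′ (punchIn-injective i _ _ (trans eq (sym (punchIn-punchOut i≢j)))))

point : Fin n → ℕ → Fin n → ℕ
point x a y = if ⌊ y ≟ x ⌋ then a else 0

twoPoints : Fin n → ℕ → Fin n → ℕ → Fin n → ℕ
twoPoints p a q b y = if ⌊ y ≟ p ⌋ then a else point q b y

module _ (x : Fin n) (a : ℕ) where

  point-self : point x a x ≡ a
  point-self with x ≟ x
  ... | yes _ = refl
  ... | no x≢x = contradiction refl x≢x

  point-outside : ∀ {y} → y ≢ x → point x a y ≡ 0
  point-outside {y} y≢x with y ≟ x
  ... | yes y≡x = contradiction y≡x y≢x
  ... | no _ = refl

  point-support : ∀ y → 0 < point x a y → y ≡ x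
  point-support y pos with y ≟ x
  ... | yes y≡x = y≡x
  ... | no _ = contradiction pos λ ()

  point-≤ : ∀ y → point x a y ≤ a
  point-≤ y with y ≟ x
  ... | yes _ = ≤-refl
  ... | no _ = z≤n

  sum-point : sum (point x a) ≡ a
  sum-point = trans (sum-single (point x a) (λ _ → point-outside)) point-self

module _ (p : Fin n) (a : ℕ) (q : Fin n) (b : ℕ) where

  twoPoints-fst : twoPoints p a q b p ≡ a
  twoPoints-fst with p ≟ p
  ... | yes _ = refl
  ... | no p≢p = contradiction refl p≢p

  twoPoints-snd : p ≢ q → twoPoints p a q b q ≡ b
  twoPoints-snd p≢q with q ≟ p
  ... | yes q≡p = contradiction (sym q≡p) p≢q
  ... | no _ = point-self q b

  twoPoints-outside : ∀ {y} → y ≢ p → y ≢ q → twoPoints p a q b y ≡ 0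
  twoPoints-outside {y} y≢p y≢q with y ≟ p
  ... | yes y≡p = contradiction y≡p y≢p
  ... | no _ = point-outside q b y≢q

  twoPoints-support : ∀ y → 0 < twoPoints p a q b y → y ≡ p ⊎ y ≡ q
  twoPoints-support y pos with y ≟ p
  ... | yes y≡p = inj₁ y≡p
  ... | no _ = inj₂ (point-support q b y pos)

  twoPoints-≤ : ∀ {m} → a ≤ m → b ≤ m → ∀ y → twoPoints p a q b y ≤ m
  twoPoints-≤ a≤m b≤m y with y ≟ p
  ... | yes _ = a≤m
  ... | no _ = ≤-trans (point-≤ q b y) b≤m

  sum-twoPoints : p ≢ q → sum (twoPoints p a q b) ≡ a + b
  sum-twoPoints p≢q = trans (sum-pair _ p≢q (λ _ → twoPoints-outside))
                            (cong₂ _+_ twoPoints-fst (twoPoints-snd p≢q))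

module _ (G : Graph n) where

  Adj-sym : ∀ {x y} → Adj G x y → Adj G y x
  Adj-sym {x} {y} xy = trans (adjSym G y x) xy

  Adj-irrefl : ∀ {x} → ¬ Adj G x x
  Adj-irrefl {x} xx with () ← trans (sym (irref G x)) xx

  Adj⇒≢ : ∀ {x y} → Adj G x y → x ≢ y
  Adj⇒≢ xy refl = Adj-irrefl xy

toWitness-∧ : ∀ {A B : Set} (a? : Dec A) (b? : Dec B) → T (⌊ a? ⌋ ∧ ⌊ b? ⌋) → A × B
toWitness-∧ a? b? = Product.map (toWitness {a? = a?}) (toWitness {a? = b?}) ∘ to (T-∧ {⌊ a? ⌋})

module _ (G : Graph n) {u v : Fin n} where

  Adj-addEdge⁺ : (uv : NonEdge G u v) → ∀ {x y} → Adj G x y → Adj (addEdge G u v uv) x y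
  Adj-addEdge⁺ (_ , _) xy rewrite xy = refl

  Adj-addEdge-new : (uv : NonEdge G u v) → Adj (addEdge G u v uv) u v
  Adj-addEdge-new (_ , _) with u ≟ u | v ≟ v
  ... | yes _ | yes _ = ∨-zeroʳ (adj G u v)
  ... | no u≢u | _ = contradiction refl u≢u
  ... | _ | no v≢v = contradiction refl v≢v

  Adj-addEdge⁻ : (uv : NonEdge G u v) → ∀ {x y} → Adj (addEdge G u v uv) x y →
                 Adj G x y ⊎ (x ≡ u × y ≡ v) ⊎ (x ≡ v × y ≡ u)
  Adj-addEdge⁻ (_ , _) {x} {y} xy with to (T-∨ {adj G x y}) (from T-≡ xy)
  ... | inj₁ old = inj₁ (to T-≡ old)
  ... | inj₂ new with to (T-∨ {⌊ x ≟ u ⌋ ∧ ⌊ y ≟ v ⌋}) new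
  ...   | inj₁ xu∧yv = inj₂ (inj₁ (toWitness-∧ (x ≟ u) (y ≟ v) xu∧yv))
  ...   | inj₂ xv∧yu = inj₂ (inj₂ (toWitness-∧ (x ≟ v) (y ≟ u) xv∧yu))

ones-TRDF : (G : Graph n) → NoIsolated G → IsTRDF G (λ _ → 1)
ones-TRDF G noIsolated = record
  { range = λ _ → s≤s z≤n
  ; dom = λ _ ()
  ; total = λ y _ → proj₁ (noIsolated y) , proj₂ (noIsolated y) , s≤s z≤n
  }

weight-ones : ∀ n → weight {n} (λ _ → 1) ≡ n
weight-ones n = trans (weight≡sum {n} (λ _ → 1)) (sum-ones n)

-- Minimality quantifies over all functions Fin n → ℕ, so constructively only the double
-- negation of the existence of γ_tR is available.
¬¬-GammaTR : (G : Graph n) {f : Fin n → ℕ} → IsTRDF G f → ¬ ¬ ∃ (GammaTR G)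
¬¬-GammaTR {n} G {f} f-trdf noMinimum = <-rec NoTRDFOfWeight step (weight f) (f , f-trdf , refl)
  where
  NoTRDFOfWeight : ℕ → Set
  NoTRDFOfWeight w = ¬ Σ (Fin n → ℕ) λ g → IsTRDF G g × weight g ≡ w
  step : ∀ w → (∀ {w′} → w′ < w → NoTRDFOfWeight w′) → NoTRDFOfWeight w
  step w smaller g-of-weight-w = noMinimum (w , g-of-weight-w , minimal)
    where
    minimal : ∀ h → IsTRDF G h → w ≤ weight h
    minimal h h-trdf with w ≤? weight h
    ... | yes w≤h = w≤h
    ... | no w≰h = contradiction (h , h-trdf , refl) (smaller (≰⇒> w≰h))

Universal : Graph n → Fin n → Set
Universal G w = ∀ y → y ≢ w → Adj G w y

DominatingEdge : Graph n → Set
DominatingEdge {n} G = Σ (Fin n) λ p → Σ (Fin n) λ x →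
  Adj G p x × (∀ y → y ≢ p → y ≢ x → Adj G y p ⊎ Adj G y x)

dominatingEdge⇒TRDF : (G : Graph n) → DominatingEdge G →
                      Σ (Fin n → ℕ) λ f → IsTRDF G f × weight f ≡ 4
dominatingEdge⇒TRDF {n} G (p , x , px , dominated) =
  f , f-trdf , trans (weight≡sum f) (sum-twoPoints p 2 x 2 p≢x)
  where
  p≢x : p ≢ x
  p≢x = Adj⇒≢ G px
  f : Fin n → ℕ
  f = twoPoints p 2 x 2
  f-p : f p ≡ 2
  f-p = twoPoints-fst p 2 x 2
  f-x : f x ≡ 2
  f-x = twoPoints-snd p 2 x 2 p≢x
  dom : ∀ y → f y ≡ 0 → ∃ λ z → Adj G y z × f z ≡ 2
  dom y fy≡0 with dominated y (λ { refl → contradiction (trans (sym fy≡0) f-p) λ () })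
                              (λ { refl → contradiction (trans (sym fy≡0) f-x) λ () })
  ... | inj₁ yp = p , yp , f-p
  ... | inj₂ yx = x , yx , f-x
  total : ∀ y → 0 < f y → ∃ λ z → Adj G y z × 0 < f z
  total y fy>0 with twoPoints-support p 2 x 2 y fy>0
  ... | inj₁ refl = x , px , subst (0 <_) (sym f-x) (s≤s z≤n)
  ... | inj₂ refl = p , Adj-sym G px , subst (0 <_) (sym f-p) (s≤s z≤n)
  f-trdf : IsTRDF G f
  f-trdf = record { range = twoPoints-≤ p 2 x 2 ≤-refl ≤-refl ; dom = dom ; total = total }

light-TRDF⇒universal : (G : Graph n) {g : Fin n → ℕ} → IsTRDF G g → sum g ≤ 3 →
                       ∀ {x} → g x ≡ 0 → ∃ (Universal G)
light-TRDF⇒universal G {g} g-trdf sum≤3 {x} gx≡0 with IsTRDF.dom g-trdf x gx≡0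
... | w , _ , gw≡2 with IsTRDF.total g-trdf w (subst (0 <_) (sym gw≡2) (s≤s z≤n))
...   | z , wz , gz>0 = w , universal
  where
  open ≤-Reasoning
  only-w-is-heavy : ∀ {w′} → w ≢ w′ → g w′ ≢ 2
  only-w-is-heavy w≢w′ gw′≡2 = contradiction
    (begin
      4          ≡⟨ cong₂ _+_ gw≡2 gw′≡2 ⟨
      g w + g _  ≤⟨ pair≤sum g w≢w′ ⟩
      sum g      ≤⟨ sum≤3 ⟩
      3          ∎)
    λ { (s≤s (s≤s (s≤s ()))) }
  light-elsewhere : ∀ {y} → w ≢ y → z ≢ y → g y ≡ 0
  light-elsewhere {y} w≢y z≢y = n≤0⇒n≡0 (+-cancelˡ-≤ 3 (g y) 0 (begin
    3 + g y            ≤⟨ +-monoˡ-≤ (g y) (+-monoʳ-≤ 2 gz>0) ⟩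
    2 + g z + g y      ≡⟨ cong (λ a → a + g z + g y) gw≡2 ⟨
    g w + g z + g y    ≤⟨ triple≤sum g (Adj⇒≢ G wz) w≢y z≢y ⟩
    sum g              ≤⟨ sum≤3 ⟩
    3                  ∎))
  universal : Universal G w
  universal y y≢w with y ≟ z
  ... | yes refl = wz
  ... | no y≢z with IsTRDF.dom g-trdf y (light-elsewhere (≢-sym y≢w) (≢-sym y≢z))
  ...   | w′ , yw′ , gw′≡2 with w ≟ w′
  ...     | yes refl = Adj-sym G yw′
  ...     | no w≢w′ = contradiction gw′≡2 (only-w-is-heavy w≢w′)

NearlyUniversal : Graph n → Fin n → Fin n → Set
NearlyUniversal G w q = ¬ Adj G w q × (∀ y → y ≢ w → Adj G w y ⊎ y ≡ q)

nearlyUniversal⇒dominatingEdge : (G : Graph n) → NoIsolated G →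
                                 ∀ {w q} → NearlyUniversal G w q → DominatingEdge G
nearlyUniversal⇒dominatingEdge {n} G noIsolated {w} {q} (¬wq , nearly) = w , x , wx , dominated
  where
  x : Fin n
  x = proj₁ (noIsolated q)
  qx : Adj G q x
  qx = proj₂ (noIsolated q)
  wx : Adj G w x
  wx with nearly x (λ { refl → ¬wq (Adj-sym G qx) })
  ... | inj₁ wx = wx
  ... | inj₂ x≡q = contradiction (subst (Adj G q) x≡q qx) (Adj-irrefl G)
  dominated : ∀ y → y ≢ w → y ≢ x → Adj G y w ⊎ Adj G y x
  dominated y y≢w _ = Sum.map (Adj-sym G) (λ { refl → qx }) (nearly y y≢w)

universal-addEdge⇒nearlyUniversal : (G : Graph n) {u v : Fin n} (uv : NonEdge G u v) →
  ∀ {w} → Universal (addEdge G u v uv) w → ∃ (NearlyUniversal G w)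
universal-addEdge⇒nearlyUniversal G {u} {v} (u≢v , ¬uv) {w} universal⁺ =
  nearly (λ y y≢w → Adj-addEdge⁻ G (u≢v , ¬uv) (universal⁺ y y≢w))
  where
  nearly : (∀ y → y ≢ w → Adj G w y ⊎ (w ≡ u × y ≡ v) ⊎ (w ≡ v × y ≡ u)) → ∃ (NearlyUniversal G w)
  nearly cases with w ≟ u | w ≟ v
  ... | yes refl | _ = v , ¬uv , case
    where
    case : ∀ y → y ≢ w → Adj G w y ⊎ y ≡ v
    case y y≢w with cases y y≢w
    ... | inj₁ wy = inj₁ wy
    ... | inj₂ (inj₁ (_ , y≡v)) = inj₂ y≡v
    ... | inj₂ (inj₂ (u≡v , _)) = contradiction u≡v u≢v
  ... | no w≢u | yes refl = u , ¬uv ∘ Adj-sym G , case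
    where
    case : ∀ y → y ≢ w → Adj G w y ⊎ y ≡ u
    case y y≢w with cases y y≢w
    ... | inj₁ wy = inj₁ wy
    ... | inj₂ (inj₁ (v≡u , _)) = contradiction v≡u w≢u
    ... | inj₂ (inj₂ (_ , y≡u)) = inj₂ y≡u
  ... | no w≢u | no w≢v = w , Adj-irrefl G , case
    where
    case : ∀ y → y ≢ w → Adj G w y ⊎ y ≡ w
    case y y≢w with cases y y≢w
    ... | inj₁ wy = inj₁ wy
    ... | inj₂ (inj₁ (w≡u , _)) = contradiction w≡u w≢u
    ... | inj₂ (inj₂ (w≡v , _)) = contradiction w≡v w≢v

no-5-supercritical : (G : Graph n) → ¬ EdgeSupercritical G 5
no-5-supercritical {n} G (noIsolated , (_ , γ≥5) , (u , v , uv) , critical) =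
  ¬¬-GammaTR G⁺ (ones-TRDF G⁺ noIsolated⁺) λ (m , γ⁺≡m) →
    noLightTRDF (proj₁ γ⁺≡m) (+-cancelʳ-≤ 2 m 3 (critical u v uv m γ⁺≡m))
  where
  G⁺ : Graph n
  G⁺ = addEdge G u v uv
  noIsolated⁺ : NoIsolated G⁺
  noIsolated⁺ y = Product.map₂ (Adj-addEdge⁺ G uv) (noIsolated y)
  ¬dominatingEdge : ¬ DominatingEdge G
  ¬dominatingEdge edge with dominatingEdge⇒TRDF G edge
  ... | f , f-trdf , wf≡4 =
    contradiction (subst (5 ≤_) wf≡4 (γ≥5 f f-trdf)) λ { (s≤s (s≤s (s≤s (s≤s ())))) }
  5≤n : 5 ≤ n
  5≤n = subst (5 ≤_) (weight-ones n) (γ≥5 _ (ones-TRDF G noIsolated))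
  noLightTRDF : ∀ {m} → (Σ (Fin n → ℕ) λ g → IsTRDF G⁺ g × weight g ≡ m) → m ≤ 3 → ⊥
  noLightTRDF (g , g-trdf , refl) weight≤3 =
    ¬dominatingEdge (nearlyUniversal⇒dominatingEdge G noIsolated (proj₂ nearlyUniversal))
    where
    sum≤3 : sum g ≤ 3
    sum≤3 = subst (_≤ 3) (weight≡sum g) weight≤3
    zero-vertex : ∃ λ x → g x ≡ 0
    zero-vertex = sum<n⇒zero g (≤-trans (s≤s sum≤3) (≤-trans (n≤1+n 4) 5≤n))
    universal : ∃ (Universal G⁺)
    universal = light-TRDF⇒universal G⁺ g-trdf sum≤3 (proj₂ zero-vertex)
    nearlyUniversal : ∃ (NearlyUniversal G (proj₁ universal))
    nearlyUniversal = universal-addEdge⇒nearlyUniversal G uv (proj₂ universal)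

module _ (c : Fin n → Fin k) where

  Adj-Cliques⁺ : ∀ {x y} → c x ≡ c y → x ≢ y → Adj (Cliques c) x y
  Adj-Cliques⁺ {x} {y} cx≡cy x≢y with c x ≟ c y | x ≟ y
  ... | yes _ | no _ = refl
  ... | no cx≢cy | _ = contradiction cx≡cy cx≢cy
  ... | yes _ | yes x≡y = contradiction x≡y x≢y

  Adj-Cliques⁻ : ∀ {x y} → Adj (Cliques c) x y → c x ≡ c y
  Adj-Cliques⁻ {x} {y} xy with c x ≟ c y
  ... | yes cx≡cy = cx≡cy
  ... | no _ = contradiction xy λ ()

  ≢-components⇒NonEdge : ∀ {x y} → c x ≢ c y → NonEdge (Cliques c) x y
  ≢-components⇒NonEdge cx≢cy = (λ { refl → cx≢cy refl }) , cx≢cy ∘ Adj-Cliques⁻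

  NonEdge⇒≢-components : ∀ {x y} → NonEdge (Cliques c) x y → c x ≢ c y
  NonEdge⇒≢-components (x≢y , ¬xy) cx≡cy = ¬xy (Adj-Cliques⁺ cx≡cy x≢y)

  componentwise : (Fin k → Fin n → ℕ) → Fin n → ℕ
  componentwise F y = F (c y) y

  componentwise-≡ : (F : Fin k → Fin n → ℕ) → ∀ {y z} → c z ≡ c y → componentwise F z ≡ F (c y) z
  componentwise-≡ F {z = z} cz≡cy = cong (λ i → F i z) cz≡cy

  sum-componentwise : (F : Fin k → Fin n → ℕ) → (∀ i y → c y ≢ i → F i y ≡ 0) →
                      sum (componentwise F) ≡ sum (λ i → sum (F i))
  sum-componentwise F outside = trans
    (sum-cong-≗ λ y → sym (sum-single (λ i → F i y) (λ i i≢cy → outside i y (≢-sym i≢cy))))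
    (∑-comm (λ y i → F i y))

  onComponent : (Fin n → ℕ) → Fin k → Fin n → ℕ
  onComponent g i y = point (c y) (g y) i

  onComponent-inside : (g : Fin n → ℕ) → ∀ {i y} → c y ≡ i → onComponent g i y ≡ g y
  onComponent-inside g {y = y} refl = point-self (c y) (g y)

  sum-onComponent : (g : Fin n → ℕ) → sum g ≡ sum (λ i → sum (onComponent g i))
  sum-onComponent g = trans (sum-cong-≗ {x = g} λ y → sym (onComponent-inside g {y = y} refl))
    (sum-componentwise (onComponent g) (λ i y cy≢i → point-outside (c y) (g y) (≢-sym cy≢i)))

module CliqueUnion (c : Fin n → Fin k) (large : ∀ i → AtLeast3 c i) where

  anchor partner : Fin k → Fin n
  anchor i = proj₁ (large i)
  partner i = proj₁ (proj₂ (large i))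

  c-anchor : ∀ i → c (anchor i) ≡ i
  c-anchor i with large i
  ... | _ , _ , _ , ca≡i , _ = ca≡i

  c-partner : ∀ i → c (partner i) ≡ i
  c-partner i with large i
  ... | _ , _ , _ , _ , cb≡i , _ = cb≡i

  anchor≢partner : ∀ i → anchor i ≢ partner i
  anchor≢partner i with large i
  ... | _ , _ , _ , _ , _ , _ , a≢b , _ = a≢b

  roman : Fin k → Fin n → ℕ
  roman i = twoPoints (anchor i) 2 (partner i) 1

  roman-anchor : ∀ i → roman i (anchor i) ≡ 2
  roman-anchor i = twoPoints-fst (anchor i) 2 (partner i) 1

  roman-partner : ∀ i → roman i (partner i) ≡ 1
  roman-partner i = twoPoints-snd (anchor i) 2 (partner i) 1 (anchor≢partner i)

  roman-≤ : ∀ i y → roman i y ≤ 2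
  roman-≤ i = twoPoints-≤ (anchor i) 2 (partner i) 1 ≤-refl (s≤s z≤n)

  roman-outside : ∀ i y → c y ≢ i → roman i y ≡ 0
  roman-outside i y cy≢i = twoPoints-outside (anchor i) 2 (partner i) 1 {y}
    (λ { refl → cy≢i (c-anchor i) }) (λ { refl → cy≢i (c-partner i) })

  sum-roman : ∀ i → sum (roman i) ≡ 3
  sum-roman i = sum-twoPoints (anchor i) 2 (partner i) 1 (anchor≢partner i)

  roman-dom : ∀ y → roman (c y) y ≡ 0 → Adj (Cliques c) y (anchor (c y))
  roman-dom y ≡0 = Adj-Cliques⁺ c (sym (c-anchor (c y))) λ y≡a →
    contradiction (trans (sym ≡0) (trans (cong (roman (c y)) y≡a) (roman-anchor (c y)))) λ ()

  roman-total : ∀ y → 0 < roman (c y) y →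
                ∃ λ z → Adj (Cliques c) y z × c z ≡ c y × 0 < roman (c y) z
  roman-total y >0 with twoPoints-support (anchor (c y)) 2 (partner (c y)) 1 y >0
  ... | inj₁ y≡a =
    partner (c y) , Adj-Cliques⁺ c (sym (c-partner (c y))) (λ y≡b → a≢b (trans (sym y≡a) y≡b)) ,
    c-partner (c y) , subst (0 <_) (sym (roman-partner (c y))) (s≤s z≤n)
    where
    a≢b : anchor (c y) ≢ partner (c y)
    a≢b = anchor≢partner (c y)
  ... | inj₂ y≡b =
    anchor (c y) , Adj-Cliques⁺ c (sym (c-anchor (c y))) (λ y≡a → a≢b (trans (sym y≡a) y≡b)) ,
    c-anchor (c y) , subst (0 <_) (sym (roman-anchor (c y))) (s≤s z≤n)
    where
    a≢b : anchor (c y) ≢ partner (c y)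
    a≢b = anchor≢partner (c y)

  roman-TRDF : IsTRDF (Cliques c) (componentwise c roman)
  roman-TRDF = record { range = λ y → roman-≤ (c y) y ; dom = dom ; total = total }
    where
    dom : ∀ y → roman (c y) y ≡ 0 → ∃ λ z → Adj (Cliques c) y z × roman (c z) z ≡ 2
    dom y ≡0 = anchor (c y) , roman-dom y ≡0 ,
               trans (componentwise-≡ c roman (c-anchor (c y))) (roman-anchor (c y))
    total : ∀ y → 0 < roman (c y) y → ∃ λ z → Adj (Cliques c) y z × 0 < roman (c z) z
    total y >0 with roman-total y >0
    ... | z , yz , cz≡cy , >0′ = z , yz , subst (0 <_) (sym (componentwise-≡ c roman cz≡cy)) >0′

  sum-3k : sum {k} (λ _ → 3) ≡ 3 * k
  sum-3k = trans (sum-const k 3) (*-comm k 3)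

  weight-roman : weight (componentwise c roman) ≡ 3 * k
  weight-roman = begin
    weight (componentwise c roman)      ≡⟨ weight≡sum (componentwise c roman) ⟩
    sum (componentwise c roman)         ≡⟨ sum-componentwise c roman roman-outside ⟩
    sum (λ i → sum (roman i))           ≡⟨ sum-cong-≗ sum-roman ⟩
    sum {k} (λ _ → 3)                   ≡⟨ sum-3k ⟩
    3 * k                               ∎
    where open ≡-Reasoning

  module _ {g : Fin n → ℕ} (g-trdf : IsTRDF (Cliques c) g) where

    zero⇒component-weight≥3 : ∀ {i y} → c y ≡ i → g y ≡ 0 → 3 ≤ sum (onComponent c g i)
    zero⇒component-weight≥3 {i} {y} cy≡i gy≡0 with IsTRDF.dom g-trdf y gy≡0
    ... | w , yw , gw≡2 with IsTRDF.total g-trdf w (subst (0 <_) (sym gw≡2) (s≤s z≤n))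
    ...   | z , wz , gz>0 = begin
      2 + 1                                      ≤⟨ +-monoʳ-≤ 2 gz>0 ⟩
      2 + g z                                    ≡⟨ cong₂ _+_ (trans (inside cw≡i) gw≡2) (inside cz≡i) ⟨
      onComponent c g i w + onComponent c g i z  ≤⟨ pair≤sum _ (Adj⇒≢ (Cliques c) wz) ⟩
      sum (onComponent c g i)                    ∎
      where
      open ≤-Reasoning
      inside : ∀ {y} → c y ≡ i → onComponent c g i y ≡ g y
      inside = onComponent-inside c g
      cw≡i : c w ≡ i
      cw≡i = trans (sym (Adj-Cliques⁻ c yw)) cy≡i
      cz≡i : c z ≡ i
      cz≡i = trans (sym (Adj-Cliques⁻ c wz)) cw≡i

    component-weight≥3 : ∀ i → 3 ≤ sum (onComponent c g i)
    component-weight≥3 i with large i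
    ... | a , b , d , ca≡i , cb≡i , cd≡i , a≢b , a≢d , b≢d with g a ≟ℕ 0 | g b ≟ℕ 0 | g d ≟ℕ 0
    ...   | yes ga≡0 | _ | _ = zero⇒component-weight≥3 ca≡i ga≡0
    ...   | _ | yes gb≡0 | _ = zero⇒component-weight≥3 cb≡i gb≡0
    ...   | _ | _ | yes gd≡0 = zero⇒component-weight≥3 cd≡i gd≡0
    ...   | no ga≢0 | no gb≢0 | no gd≢0 = begin
      1 + 1 + 1
        ≤⟨ +-mono-≤ (+-mono-≤ (n≢0⇒n>0 ga≢0) (n≢0⇒n>0 gb≢0)) (n≢0⇒n>0 gd≢0) ⟩
      g a + g b + g d
        ≡⟨ cong₂ _+_ (cong₂ _+_ (inside ca≡i) (inside cb≡i)) (inside cd≡i) ⟨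
      onComponent c g i a + onComponent c g i b + onComponent c g i d
        ≤⟨ triple≤sum _ a≢b a≢d b≢d ⟩
      sum (onComponent c g i)
        ∎
      where
      open ≤-Reasoning
      inside : ∀ {y} → c y ≡ i → onComponent c g i y ≡ g y
      inside = onComponent-inside c g

    weight≥3k : 3 * k ≤ weight g
    weight≥3k = begin
      3 * k                                ≡⟨ sum-3k ⟨
      sum {k} (λ _ → 3)                    ≤⟨ sum-mono-≤ component-weight≥3 ⟩
      sum (λ i → sum (onComponent c g i))  ≡⟨ sum-onComponent c g ⟨
      sum g                                ≡⟨ weight≡sum g ⟨
      weight g                             ∎
      where open ≤-Reasoning

  γ≡3k : GammaTR (Cliques c) (3 * k)
  γ≡3k = (componentwise c roman , roman-TRDF , weight-roman) , λ _ → weight≥3k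

  noIsolated : NoIsolated (Cliques c)
  noIsolated y with y ≟ anchor (c y)
  ... | yes y≡a =
    partner (c y) , Adj-Cliques⁺ c (sym (c-partner (c y))) (anchor≢partner (c y) ∘ trans (sym y≡a))
  ... | no y≢a = anchor (c y) , Adj-Cliques⁺ c (sym (c-anchor (c y))) y≢a

  module Critical {u v : Fin n} (uv : NonEdge (Cliques c) u v) where

    G⁺ : Graph n
    G⁺ = addEdge (Cliques c) u v uv

    cu≢cv : c u ≢ c v
    cu≢cv = NonEdge⇒≢-components c uv

    critical : Fin k → Fin n → ℕ
    critical i = if ⌊ i ≟ c u ⌋ then point u 2 else if ⌊ i ≟ c v ⌋ then point v 2 else roman i

    critical-cases : ∀ i → (i ≡ c u × critical i ≡ point u 2)
                         ⊎ (i ≡ c v × critical i ≡ point v 2)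
                         ⊎ (i ≢ c u × i ≢ c v × critical i ≡ roman i)
    critical-cases i with i ≟ c u | i ≟ c v
    ... | yes i≡cu | _ = inj₁ (i≡cu , refl)
    ... | no _ | yes i≡cv = inj₂ (inj₁ (i≡cv , refl))
    ... | no i≢cu | no i≢cv = inj₂ (inj₂ (i≢cu , i≢cv , refl))

    f⁺ : Fin n → ℕ
    f⁺ = componentwise c critical

    f⁺-u : f⁺ u ≡ 2
    f⁺-u with critical-cases (c u)
    ... | inj₁ (_ , eq) = trans (cong-app eq u) (point-self u 2)
    ... | inj₂ (inj₁ (cu≡cv , _)) = contradiction cu≡cv cu≢cv
    ... | inj₂ (inj₂ (cu≢cu , _)) = contradiction refl cu≢cu

    f⁺-v : f⁺ v ≡ 2
    f⁺-v with critical-cases (c v)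
    ... | inj₁ (cv≡cu , _) = contradiction (sym cv≡cu) cu≢cv
    ... | inj₂ (inj₁ (_ , eq)) = trans (cong-app eq v) (point-self v 2)
    ... | inj₂ (inj₂ (_ , cv≢cv , _)) = contradiction refl cv≢cv

    critical-outside : ∀ i y → c y ≢ i → critical i y ≡ 0
    critical-outside i y cy≢i with critical-cases i
    ... | inj₁ (i≡cu , eq) = trans (cong-app eq y) (point-outside u 2 λ { refl → cy≢i (sym i≡cu) })
    ... | inj₂ (inj₁ (i≡cv , eq)) = trans (cong-app eq y) (point-outside v 2 λ { refl → cy≢i (sym i≡cv) })
    ... | inj₂ (inj₂ (_ , _ , eq)) = trans (cong-app eq y) (roman-outside i y cy≢i)

    deficit : Fin k → ℕ
    deficit = twoPoints (c u) 1 (c v) 1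

    sum-critical+deficit : ∀ i → sum (critical i) + deficit i ≡ 3
    sum-critical+deficit i with critical-cases i
    ... | inj₁ (refl , eq) =
      cong₂ _+_ (trans (cong sum eq) (sum-point u 2)) (twoPoints-fst (c u) 1 (c v) 1)
    ... | inj₂ (inj₁ (refl , eq)) =
      cong₂ _+_ (trans (cong sum eq) (sum-point v 2)) (twoPoints-snd (c u) 1 (c v) 1 cu≢cv)
    ... | inj₂ (inj₂ (i≢cu , i≢cv , eq)) =
      cong₂ _+_ (trans (cong sum eq) (sum-roman i)) (twoPoints-outside (c u) 1 (c v) 1 i≢cu i≢cv)

    weight-f⁺ : weight f⁺ + 2 ≡ 3 * k
    weight-f⁺ = begin
      weight f⁺ + 2
        ≡⟨ cong₂ _+_ (weight≡sum f⁺) (sym (sum-twoPoints (c u) 1 (c v) 1 cu≢cv)) ⟩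
      sum f⁺ + sum deficit
        ≡⟨ cong (_+ sum deficit) (sum-componentwise c critical critical-outside) ⟩
      sum (λ i → sum (critical i)) + sum deficit
        ≡⟨ ∑-distrib-+ (λ i → sum (critical i)) deficit ⟨
      sum (λ i → sum (critical i) + deficit i)
        ≡⟨ sum-cong-≗ sum-critical+deficit ⟩
      sum {k} (λ _ → 3)
        ≡⟨ sum-3k ⟩
      3 * k
        ∎
      where open ≡-Reasoning

    f⁺-away : ∀ {y z} → c z ≡ c y → critical (c y) ≡ roman (c y) → f⁺ z ≡ roman (c y) z
    f⁺-away {z = z} cz≡cy eq = trans (componentwise-≡ c critical cz≡cy) (cong-app eq z)

    f⁺-TRDF : IsTRDF G⁺ f⁺
    f⁺-TRDF = record { range = range ; dom = dom ; total = total }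
      where
      range : ∀ y → f⁺ y ≤ 2
      range y with critical-cases (c y)
      ... | inj₁ (_ , eq) = subst (_≤ 2) (sym (cong-app eq y)) (point-≤ u 2 y)
      ... | inj₂ (inj₁ (_ , eq)) = subst (_≤ 2) (sym (cong-app eq y)) (point-≤ v 2 y)
      ... | inj₂ (inj₂ (_ , _ , eq)) = subst (_≤ 2) (sym (cong-app eq y)) (roman-≤ (c y) y)

      dom : ∀ y → f⁺ y ≡ 0 → ∃ λ z → Adj G⁺ y z × f⁺ z ≡ 2
      dom y ≡0 with critical-cases (c y)
      ... | inj₁ (cy≡cu , eq) = u , Adj-addEdge⁺ (Cliques c) uv (Adj-Cliques⁺ c cy≡cu y≢u) , f⁺-u
        where
        y≢u : y ≢ u
        y≢u refl = contradiction (trans (sym ≡0) (trans (cong-app eq y) (point-self u 2))) λ ()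
      ... | inj₂ (inj₁ (cy≡cv , eq)) = v , Adj-addEdge⁺ (Cliques c) uv (Adj-Cliques⁺ c cy≡cv y≢v) , f⁺-v
        where
        y≢v : y ≢ v
        y≢v refl = contradiction (trans (sym ≡0) (trans (cong-app eq y) (point-self v 2))) λ ()
      ... | inj₂ (inj₂ (_ , _ , eq)) =
        anchor (c y) , Adj-addEdge⁺ (Cliques c) uv (roman-dom y (trans (sym (cong-app eq y)) ≡0)) ,
        trans (f⁺-away (c-anchor (c y)) eq) (roman-anchor (c y))

      total : ∀ y → 0 < f⁺ y → ∃ λ z → Adj G⁺ y z × 0 < f⁺ z
      total y >0 with critical-cases (c y)
      ... | inj₁ (_ , eq) with point-support u 2 y (subst (0 <_) (cong-app eq y) >0)
      ...   | refl = v , Adj-addEdge-new (Cliques c) uv , subst (0 <_) (sym f⁺-v) (s≤s z≤n)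
      total y >0 | inj₂ (inj₁ (_ , eq)) with point-support v 2 y (subst (0 <_) (cong-app eq y) >0)
      ...   | refl = u , Adj-sym G⁺ (Adj-addEdge-new (Cliques c) uv) , subst (0 <_) (sym f⁺-u) (s≤s z≤n)
      total y >0 | inj₂ (inj₂ (_ , _ , eq)) with roman-total y (subst (0 <_) (cong-app eq y) >0)
      ...   | z , yz , cz≡cy , >0′ =
        z , Adj-addEdge⁺ (Cliques c) uv yz , subst (0 <_) (sym (f⁺-away cz≡cy eq)) >0′

    γ⁺+2≤3k : ∀ m → GammaTR G⁺ m → m + 2 ≤ 3 * k
    γ⁺+2≤3k m (_ , minimal) = subst (m + 2 ≤_) weight-f⁺ (+-monoˡ-≤ 2 (minimal f⁺ f⁺-TRDF))

cliques-supercritical : (c : Fin n → Fin k) → 2 ≤ k → (∀ i → AtLeast3 c i) →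
                        EdgeSupercritical (Cliques c) (3 * k)
cliques-supercritical c (s≤s (s≤s _)) large =
  noIsolated , γ≡3k , (anchor zero , anchor (suc zero) , ≢-components⇒NonEdge c anchors-apart) ,
  λ _ _ uv → Critical.γ⁺+2≤3k uv
  where
  open CliqueUnion c large
  anchors-apart : c (anchor zero) ≢ c (anchor (suc zero))
  anchors-apart eq with trans (sym (c-anchor zero)) (trans eq (c-anchor (suc zero)))
  ... | ()

mainTheorem9 : (∀ (n : ℕ) (G : Graph n) → ¬ EdgeSupercritical G 5)
    × (∀ (n k : ℕ) (c : Fin n → Fin k) → 2 ≤ k → (∀ i → AtLeast3 c i)
       → EdgeSupercritical (Cliques c) (3 * k))
mainTheorem9 = (λ _ → no-5-supercritical) , (λ _ _ → cliques-supercritical)
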